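{- Let $\mathbf A\in\mathbf{I}_{2,0}$. Then the relation $\sqsubseteq$ is antisymmetric on $A$: if $a\sqsubseteq b$ and $b\sqsubseteq a$ then $a=b$.
   Context: A zroupoid is an algebra $\langle A,\to,0\rangle$ with binary $\to$ and constant $0$; $x':=x\to 0$. An implication zroupoid satisfies (I) $(x\to y)\to z\approx[(z'\to x)\to(y\to z)']'$ and $0''\approx 0$; $\mathbf{I}_{2,0}$ is the variety of implication zroupoids satisfying $x''\approx x$. For $x,y\in A$, $x\sqsubseteq y$ iff $(x\to y')'=x$. -}

module Defs where

open import Level using (Level; suc)
open import Relation.Binary.PropositionalEquality using (_≡_)

record Zroupoid (a : Level) : Set (suc a) where
  infixr 5 _⇒_
  field
    Carrier : Set a
    _⇒_     : Carrier → Carrier → Carrier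
    𝟎       : Carrier

  _′ : Carrier → Carrier
  x ′ = x ⇒ 𝟎

  _⊑_ : Carrier → Carrier → Set a
  x ⊑ y = ((x ⇒ (y ′)) ′) ≡ x

record IsImplicationZroupoid {a} (Z : Zroupoid a) : Set a where
  open Zroupoid Z
  field
    axI  : ∀ x y z → ((x ⇒ y) ⇒ z) ≡ (((z ′) ⇒ x) ⇒ ((y ⇒ z) ′)) ′
    0''  : (𝟎 ′) ′ ≡ 𝟎

record IsI20 {a} (Z : Zroupoid a) : Set a where
  open Zroupoid Z
  field
    isImplicationZroupoid : IsImplicationZroupoid Z
    x''≈x                 : ∀ x → (x ′) ′ ≡ x

module Submission where

-- In I_{2,0} the map x ↦ x′ is an involution, so x ⊑ y, i.e. (x ⇒ y′)′ = x,
-- says exactly that x ⇒ y′ = x′.  Three instances of identity (I) give: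
--   * x = (0′ ⇒ x′)′                    (instance x′, 0, 0 applied to x′′′′, with 0″ = 0),
--   * x = x′ ⇒ (0 ⇒ x′)′                (instance 0, 0, x′, with the above),
--   * (y ⇒ x′)′ = (x ⇒ y′) ⇒ (0 ⇒ x′)′  (instance y′, 0, x′).
-- Substituting x ⇒ y′ = x′ into the third and comparing with the second shows
-- that x ⊑ y forces (y ⇒ x′)′ = x.  Applied to a ⊑ b this reads (b ⇒ a′)′ = a,
-- while b ⊑ a reads (b ⇒ a′)′ = b; hence a = b.

open import Defs
open import Relation.Binary.PropositionalEquality
  using (_≡_; sym; trans; cong; module ≡-Reasoning)

module I20Properties {ℓ} (A : Zroupoid ℓ) (I : IsI20 A) where
  open Zroupoid A
  open IsI20 I renaming (x''≈x to ′-involutive)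
  open IsImplicationZroupoid isImplicationZroupoid
  open ≡-Reasoning

  ⊑⇒⇒′ : ∀ x y → x ⊑ y → x ⇒ y ′ ≡ x ′
  ⊑⇒⇒′ x y x⊑y = trans (sym (′-involutive (x ⇒ y ′))) (cong _′ x⊑y)

  ≡[0′⇒′]′ : ∀ x → x ≡ (𝟎 ′ ⇒ x ′) ′
  ≡[0′⇒′]′ x = begin
    x                                   ≡⟨ sym (′-involutive x) ⟩
    x ′ ′                               ≡⟨ cong _′ (sym (′-involutive (x ′))) ⟩
    ((x ′ ⇒ 𝟎) ⇒ 𝟎) ′                   ≡⟨ cong _′ (axI (x ′) 𝟎 𝟎) ⟩
    ((𝟎 ′ ⇒ x ′) ⇒ 𝟎 ′ ′) ′ ′           ≡⟨ ′-involutive _ ⟩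
    (𝟎 ′ ⇒ x ′) ⇒ 𝟎 ′ ′                 ≡⟨ cong ((𝟎 ′ ⇒ x ′) ⇒_) 0'' ⟩
    (𝟎 ′ ⇒ x ′) ′                       ∎

  ≡′⇒[0⇒′]′ : ∀ x → x ≡ x ′ ⇒ (𝟎 ⇒ x ′) ′
  ≡′⇒[0⇒′]′ x = begin
    x                                   ≡⟨ ≡[0′⇒′]′ x ⟩
    (𝟎 ′ ⇒ x ′) ′                       ≡⟨ cong _′ (axI 𝟎 𝟎 (x ′)) ⟩
    ((x ′ ′ ⇒ 𝟎) ⇒ (𝟎 ⇒ x ′) ′) ′ ′     ≡⟨ ′-involutive _ ⟩
    x ′ ′ ′ ⇒ (𝟎 ⇒ x ′) ′               ≡⟨ cong (λ u → u ⇒ (𝟎 ⇒ x ′) ′) (′-involutive (x ′)) ⟩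
    x ′ ⇒ (𝟎 ⇒ x ′) ′                   ∎

  [⇒′]′-swap : ∀ x y → (y ⇒ x ′) ′ ≡ (x ⇒ y ′) ⇒ (𝟎 ⇒ x ′) ′
  [⇒′]′-swap x y = begin
    (y ⇒ x ′) ′                         ≡⟨ cong (λ u → (u ⇒ x ′) ′) (sym (′-involutive y)) ⟩
    ((y ′ ⇒ 𝟎) ⇒ x ′) ′                 ≡⟨ cong _′ (axI (y ′) 𝟎 (x ′)) ⟩
    ((x ′ ′ ⇒ y ′) ⇒ (𝟎 ⇒ x ′) ′) ′ ′   ≡⟨ ′-involutive _ ⟩
    (x ′ ′ ⇒ y ′) ⇒ (𝟎 ⇒ x ′) ′         ≡⟨ cong (λ u → (u ⇒ y ′) ⇒ (𝟎 ⇒ x ′) ′) (′-involutive x) ⟩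
    (x ⇒ y ′) ⇒ (𝟎 ⇒ x ′) ′             ∎

  ⊑⇒[⇒′]′≡ : ∀ x y → x ⊑ y → (y ⇒ x ′) ′ ≡ x
  ⊑⇒[⇒′]′≡ x y x⊑y = begin
    (y ⇒ x ′) ′                         ≡⟨ [⇒′]′-swap x y ⟩
    (x ⇒ y ′) ⇒ (𝟎 ⇒ x ′) ′             ≡⟨ cong (λ u → u ⇒ (𝟎 ⇒ x ′) ′) (⊑⇒⇒′ x y x⊑y) ⟩
    x ′ ⇒ (𝟎 ⇒ x ′) ′                   ≡⟨ sym (≡′⇒[0⇒′]′ x) ⟩
    x                                   ∎

lemma3p2 : ∀ {ℓ} (A : Zroupoid ℓ) → IsI20 A →
             ∀ a b → Zroupoid._⊑_ A a b → Zroupoid._⊑_ A b a → a ≡ b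
lemma3p2 A I a b a⊑b b⊑a = trans (sym (⊑⇒[⇒′]′≡ a b a⊑b)) b⊑a
  where open I20Properties A I
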